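{- Let $G=(V,E)$ be any finite simple graph with $V=\{v_1,\dots,v_n\}$ and let $J=\{(i,j') : v_i\sim v_j \text{ in } G\}$ (a symmetric subgraph of $K_{n,n}$). Then $\chi(G^k)=\chi(G)$ for all $k\ge 1$.
   Context: Let $K_{n,n}$ be the complete bipartite graph with parts $I_n=\{1,\dots,n\}$ and $I_n'=\{1',\dots,n'\}$; a subgraph $J$ of $K_{n,n}$ with vertex set $I_n\cup I_n'$ is symmetric if $i\sim j'$ iff $j\sim i'$. The self-similar graphs based on $(G,J)$: $G^1=G$; for $k\ge2$, $V(G^k)=V^k$, and $(v_{i_1},\dots,v_{i_k})\sim(v_{j_1},\dots,v_{j_k})$ in $G^k$ iff either (1) $(v_{i_1},\dots,v_{i_{k-1}})=(v_{j_1},\dots,v_{j_{k-1}})$ and $v_{i_k}\sim v_{j_k}$ in $G$, or (2) $(v_{i_1},\dots,v_{i_{k-1}})\sim(v_{j_1},\dots,v_{j_{k-1}})$ in $G^{k-1}$ and $i_k\sim j_k'$ in $J$. -}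

module Defs where

open import Level using (Level; 0ℓ)
open import Data.Nat using (ℕ; zero; suc; _<_)
open import Data.Fin using (Fin)
open import Data.Product using (_×_; Σ; ∃; _,_)
open import Data.Sum using (_⊎_)
open import Relation.Binary.PropositionalEquality using (_≡_)
open import Relation.Nullary using (¬_)

record SimpleGraph (n : ℕ) : Set₁ where
  field
    Adj      : Fin n → Fin n → Set
    sym      : ∀ {i j} → Adj i j → Adj j i
    irrefl   : ∀ {i} → ¬ Adj i i

record Graph : Set₁ where
  field
    Vtx : Set
    _∼_ : Vtx → Vtx → Set

open Graph public

-- Symmetric subgraph J of K_{n,n}: J i j means i ~ j' in J.
-- Vertices of G^(k+1) are tuples (v_{i_1},…,v_{i_k}, v_{i_{k+1}}),
-- represented as (prefix in V^k , last coordinate).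
SSVtx : ℕ → ℕ → Set
SSVtx n zero    = Fin n
SSVtx n (suc k) = SSVtx n k × Fin n

SSAdj : ∀ {n} → SimpleGraph n → (Fin n → Fin n → Set) →
        (k : ℕ) → SSVtx n k → SSVtx n k → Set
SSAdj G J zero    i       j       = SimpleGraph.Adj G i j
SSAdj G J (suc k) (p , i) (q , j) =
  (p ≡ q × SimpleGraph.Adj G i j) ⊎ (SSAdj G J k p q × J i j)

-- G^k as a graph, for k ≥ 1 (index k = suc m gives G^(m+1)).
selfSimilar : ∀ {n} → SimpleGraph n → (Fin n → Fin n → Set) → (k : ℕ) → Graph
selfSimilar {n} G J zero    = record { Vtx = Fin n ; _∼_ = SimpleGraph.Adj G } -- k = 0 never used (theorem assumes k ≥ 1); set to G
selfSimilar {n} G J (suc m) = record { Vtx = SSVtx n m ; _∼_ = SSAdj G J m }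

asGraph : ∀ {n} → SimpleGraph n → Graph
asGraph {n} G = record { Vtx = Fin n ; _∼_ = SimpleGraph.Adj G }

Colorable : Graph → ℕ → Set
Colorable H c = Σ (Vtx H → Fin c) λ f → ∀ x y → _∼_ H x y → ¬ (f x ≡ f y)

ChromaticNumber : Graph → ℕ → Set
ChromaticNumber H c = Colorable H c × (∀ c' → c' < c → ¬ Colorable H c')

-- The diagonal embedding i ↦ (i,…,i) maps G homomorphically into G^k (every
-- edge of G is an edge of J), and projecting onto the last coordinate maps G^k
-- homomorphically onto G (every edge of J is an edge of G). Colourings pull
-- back along homomorphisms, so G and G^k are colourable with the same numbers
-- of colours.
module Submission where

open import Defs
open import Data.Nat using (ℕ; zero; suc; _≥_; s≤s)
open import Data.Fin using (Fin)
open import Data.Product using (Σ; _,_)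
open import Data.Sum using (inj₁; inj₂)
open import Function.Base using (_∘_; id)
open import Function.Bundles using (_⇔_; mk⇔)
open import Relation.Binary.Core using (_⇒_)

Homomorphism : Graph → Graph → Set
Homomorphism H K = Σ (Vtx H → Vtx K) λ f → ∀ x y → _∼_ H x y → _∼_ K (f x) (f y)

colorable-pullback : ∀ {H K c} → Homomorphism H K → Colorable K c → Colorable H c
colorable-pullback (φ , φ-hom) (f , proper) =
  f ∘ φ , λ x y x∼y → proper (φ x) (φ y) (φ-hom x y x∼y)

chromaticNumber-homEquiv : ∀ {H K} → Homomorphism H K → Homomorphism K H →
  ∀ c → ChromaticNumber H c ⇔ ChromaticNumber K c
chromaticNumber-homEquiv H→K K→H c = mk⇔
  (λ (colH , minH) → colorable-pullback K→H colH ,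
                      λ c' c'<c → minH c' c'<c ∘ colorable-pullback H→K)
  (λ (colK , minK) → colorable-pullback H→K colK ,
                      λ c' c'<c → minK c' c'<c ∘ colorable-pullback K→H)

module _ {n} (G : SimpleGraph n) (J : Fin n → Fin n → Set) where
  open SimpleGraph G using (Adj)

  diagonal : ∀ m → Fin n → SSVtx n m
  diagonal zero    i = i
  diagonal (suc m) i = diagonal m i , i

  diagonal-hom : Adj ⇒ J → ∀ m → Homomorphism (asGraph G) (selfSimilar G J (suc m))
  diagonal-hom Adj⇒J m = diagonal m , preserves m
    where
    preserves : ∀ m i j → Adj i j → SSAdj G J m (diagonal m i) (diagonal m j)
    preserves zero    i j i∼j = i∼j
    preserves (suc m) i j i∼j = inj₂ (preserves m i j i∼j , Adj⇒J i∼j)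

  last : ∀ m → SSVtx n m → Fin n
  last zero    i       = i
  last (suc m) (_ , i) = i

  last-hom : J ⇒ Adj → ∀ m → Homomorphism (selfSimilar G J (suc m)) (asGraph G)
  last-hom J⇒Adj m = last m , preserves m
    where
    preserves : ∀ m x y → SSAdj G J m x y → Adj (last m x) (last m y)
    preserves zero    i       j       i∼j              = i∼j
    preserves (suc m) (_ , i) (_ , j) (inj₁ (_ , i∼j)) = i∼j
    preserves (suc m) (_ , i) (_ , j) (inj₂ (_ , iJj)) = J⇒Adj iJj

theorem3p2 : ∀ {n} (G : SimpleGraph n) (k : ℕ) → k ≥ 1 → (c : ℕ) →
    ChromaticNumber (selfSimilar G (SimpleGraph.Adj G) k) c ⇔ ChromaticNumber (asGraph G) c
theorem3p2 G (suc m) (s≤s _) =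
  chromaticNumber-homEquiv (last-hom G Adj id m) (diagonal-hom G Adj id m)
  where open SimpleGraph G using (Adj)
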